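{- SO-HORN$^r$ and SO-HORN$^{*r}$ both collapse to their existential fragments: every SO-HORN$^r$ (resp. SO-HORN$^{*r}$) formula is equivalent, on all finite structures, to a SO-HORN$^r$ (resp. SO-HORN$^{*r}$) formula in which all second-order quantifiers are existential.
   Context: All structures are finite. For a vocabulary $\tau$, SO-HORN$^r(\tau)$ is the set of second-order formulas $Q_1R_1\cdots Q_mR_m\forall\bar x\,(C_1\wedge\cdots\wedge C_n)$, where $Q_i\in\{\forall,\exists\}$, $R_1,\dots,R_m$ are relation variables not in $\tau$, and each $C_j$ is an implication $\alpha_1\wedge\cdots\wedge\alpha_l\wedge\beta_1\wedge\cdots\wedge\beta_q\to H$ in which each $\alpha_s$ is an atomic formula $R_i\bar x$ or a formula $\forall\bar yR_i\bar y\bar z$, each $\beta_t$ is an atomic or negated atomic formula $P\bar y$ with $P\notin\{R_1,\dots,R_m\}$, and $H$ is an atomic formula $R_k\bar z$ or $\bot$. SO-HORN$^{*r}$ is defined the same way except that each $\beta_t$ may be any first-order formula not containing $R_1,\dots,R_m$. -}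

module Defs where

open import Data.Nat using (ℕ; suc; _+_)
open import Data.Fin using (Fin; zero; suc)
open import Data.Vec using (Vec; map; _++_)
open import Data.List using (List; []; _∷_)
import Data.List as L
open import Data.List.Relation.Unary.All using (All)
open import Data.Product using (Σ; _×_; _,_; proj₁; proj₂)
open import Data.Bool using (Bool; T)
open import Data.Empty using (⊥)
open import Relation.Nullary using (¬_)
open import Relation.Binary.PropositionalEquality using (_≡_)
open import Function.Bundles using (_⇔_)

-- A (relational) vocabulary is a list of arities; a symbol of arity k is
-- a position in the list holding k.
Vocab : Set
Vocab = List ℕ

data Idx : List ℕ → ℕ → Set where
  here  : ∀ {k ks} → Idx (k ∷ ks) k
  there : ∀ {j k ks} → Idx ks k → Idx (j ∷ ks) k

Env : Set → List ℕ → Set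
Env A Σ = ∀ {k} → Idx Σ k → Vec A k → Bool

emptyEnv : ∀ {A} → Env A []
emptyEnv ()

_∷ₑ_ : ∀ {A k Σ} → (Vec A k → Bool) → Env A Σ → Env A (k ∷ Σ)
(R ∷ₑ ρ) here      = R
(R ∷ₑ ρ) (there i) = ρ i

record Structure (τ : Vocab) : Set where
  field
    n   : ℕ
    rel : Env (Fin (suc n)) τ

Dom : ∀ {τ} → Structure τ → Set
Dom 𝔄 = Fin (suc (Structure.n 𝔄))

-- assignments of first-order variables (de Bruijn indices Fin m)
extend : ∀ {A : Set} {m} → A → (Fin m → A) → Fin (suc m) → A
extend a e zero    = a
extend a e (suc i) = e i

data FO (τ : Vocab) : ℕ → Set where
  rel  : ∀ {m k} → Idx τ k → Vec (Fin m) k → FO τ m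
  eq   : ∀ {m} → Fin m → Fin m → FO τ m
  neg  : ∀ {m} → FO τ m → FO τ m
  and  : ∀ {m} → FO τ m → FO τ m → FO τ m
  or   : ∀ {m} → FO τ m → FO τ m → FO τ m
  all  : ∀ {m} → FO τ (suc m) → FO τ m
  ex   : ∀ {m} → FO τ (suc m) → FO τ m

evalFO : ∀ {A : Set} {τ m} → Env A τ → FO τ m → (Fin m → A) → Set
evalFO ρ (rel P xs) e = T (ρ P (map e xs))
evalFO ρ (eq x y)   e = e x ≡ e y
evalFO ρ (neg φ)    e = ¬ evalFO ρ φ e
evalFO ρ (and φ ψ)  e = evalFO ρ φ e × evalFO ρ ψ e
evalFO ρ (or φ ψ)   e = evalFO ρ φ e ⊎' evalFO ρ ψ e
  where open import Data.Sum using () renaming (_⊎_ to _⊎'_)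
evalFO {A} ρ (all φ) e = (a : A) → evalFO ρ φ (extend a e)
evalFO {A} ρ (ex φ)  e = Σ A λ a → evalFO ρ φ (extend a e)

data Atom (τ : Vocab) (m : ℕ) : Set where
  rel : ∀ {k} → Idx τ k → Vec (Fin m) k → Atom τ m
  eq  : Fin m → Fin m → Atom τ m

data Lit (τ : Vocab) (m : ℕ) : Set where
  pos : Atom τ m → Lit τ m
  neg : Atom τ m → Lit τ m

evalAtom : ∀ {A : Set} {τ m} → Env A τ → Atom τ m → (Fin m → A) → Set
evalAtom ρ (rel P xs) e = T (ρ P (map e xs))
evalAtom ρ (eq x y)   e = e x ≡ e y

evalLit : ∀ {A : Set} {τ m} → Env A τ → Lit τ m → (Fin m → A) → Set
evalLit ρ (pos a) e = evalAtom ρ a e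
evalLit ρ (neg a) e = ¬ evalAtom ρ a e

data Quant : Set where
  ∀Q ∃Q : Quant

-- Σ : arities of the quantified relation variables R₁ … R_m,
-- p : number of universally quantified first-order variables x̄.
data Alpha (Σ : List ℕ) (p : ℕ) : Set where
  atom : ∀ {k} → Idx Σ k → Vec (Fin p) k → Alpha Σ p
  -- ∀ȳ R_i ȳ z̄   (ȳ a tuple of j fresh bound variables, z̄ among x̄)
  univ : ∀ {l} (j : ℕ) → Idx Σ (j + l) → Vec (Fin p) l → Alpha Σ p

data Head (Σ : List ℕ) (p : ℕ) : Set where
  rhead : ∀ {k} → Idx Σ k → Vec (Fin p) k → Head Σ p
  bot   : Head Σ p

-- A clause α₁ ∧ … ∧ α_l ∧ β₁ ∧ … ∧ β_q → H, where the β's come from the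
-- side-formula language B (literals over τ, resp. FO formulas over τ).
record Clause (B : ℕ → Set) (Σ : List ℕ) (p : ℕ) : Set where
  constructor clause
  field
    alphas : List (Alpha Σ p)
    betas  : List (B p)
    hd     : Head Σ p

-- Q₁R₁ ⋯ Q_mR_m ∀x̄ (C₁ ∧ ⋯ ∧ C_n)
record SOHorn (B : ℕ → Set) : Set where
  constructor soHorn
  field
    prefix  : List (Quant × ℕ)
    p       : ℕ
    clauses : List (Clause B (L.map proj₂ prefix) p)

SO-HORNʳ : Vocab → Set
SO-HORNʳ τ = SOHorn (Lit τ)

SO-HORN*ʳ : Vocab → Set
SO-HORN*ʳ τ = SOHorn (FO τ)

Existential : ∀ {B} → SOHorn B → Set
Existential φ = All (λ q → proj₁ q ≡ ∃Q) (SOHorn.prefix φ)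

module _ {A : Set} where

  evalAlpha : ∀ {Σ p} → Env A Σ → Alpha Σ p → (Fin p → A) → Set
  evalAlpha ρ (atom R xs)  e = T (ρ R (map e xs))
  evalAlpha ρ (univ j R zs) e = (ys : Vec A j) → T (ρ R (ys ++ map e zs))

  evalHead : ∀ {Σ p} → Env A Σ → Head Σ p → (Fin p → A) → Set
  evalHead ρ (rhead R zs) e = T (ρ R (map e zs))
  evalHead ρ bot          e = ⊥

  evalClause : ∀ {B : ℕ → Set} {Σ p}
             → (∀ {m} → B m → (Fin m → A) → Set)
             → Env A Σ → Clause B Σ p → (Fin p → A) → Set
  evalClause evB ρ (clause as bs h) e =
    All (λ a → evalAlpha ρ a e) as → All (λ b → evB b e) bs → evalHead ρ h e

  -- second-order prefix: R₁ is the outermost quantified variable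
  evalPrefix : (pre : List (Quant × ℕ)) → (Env A (L.map proj₂ pre) → Set) → Set
  evalPrefix [] K = K emptyEnv
  evalPrefix ((∀Q , k) ∷ pre) K =
    (R : Vec A k → Bool) → evalPrefix pre (λ ρ → K (R ∷ₑ ρ))
  evalPrefix ((∃Q , k) ∷ pre) K =
    Σ (Vec A k → Bool) λ R → evalPrefix pre (λ ρ → K (R ∷ₑ ρ))

  evalSOHorn : ∀ {B : ℕ → Set}
             → (∀ {m} → B m → (Fin m → A) → Set)
             → SOHorn B → Set
  evalSOHorn evB (soHorn pre p cs) =
    evalPrefix pre λ ρ → (e : Fin p → A) → All (λ c → evalClause evB ρ c e) cs

_⊨ʳ_ : ∀ {τ} → Structure τ → SO-HORNʳ τ → Set
𝔄 ⊨ʳ φ = evalSOHorn (λ b e → evalLit (Structure.rel 𝔄) b e) φ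

_⊨*ʳ_ : ∀ {τ} → Structure τ → SO-HORN*ʳ τ → Set
𝔄 ⊨*ʳ φ = evalSOHorn (λ b e → evalFO (Structure.rel 𝔄) b e) φ

{-# OPTIONS --safe #-}
-- Every k-ary relation over a finite domain is the intersection of the total relation and of
-- the complements {v | v ≢ a} of the tuples a it omits, and the relations satisfying a Horn
-- matrix are closed under nonempty intersections: bodies are monotone and heads are positive.
-- So if only existential quantifiers follow ∀R, the formula holds for every R as soon as it holds
-- for the total relation and for every co-singleton.  This is expressed existentially by guessing
-- a relation E with E(b, a) ⇔ b ≢ a, enforced by Horn clauses, and letting the existentially
-- quantified relations after R take a as an extra parameter.  Eliminating the innermost
-- universal quantifier repeatedly leaves an existential formula.
module Submission where

open import Defs
open import Data.Bool using (Bool; true; T; _∧_; _∨_; T?)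
open import Data.Bool.Properties using (T-∧; T-∨)
open import Data.Empty using (⊥-elim)
open import Data.Maybe using (Maybe; just; nothing)
open import Data.Fin using (Fin; zero; suc; _↑ˡ_; _↑ʳ_; lift)
import Data.Fin.Properties as Fin
open import Data.List using (List; []; _∷_)
import Data.List as L
open import Data.List.Membership.Propositional using (_∈_)
open import Data.List.Relation.Unary.All as All using (All; []; _∷_)
import Data.List.Relation.Unary.All.Properties as All
open import Data.Nat using (ℕ; zero; suc; _+_)
open import Data.Nat.Properties using (+-assoc; suc-injective)
open import Data.Product using (Σ; Σ-syntax; _×_; _,_; proj₁; proj₂)
open import Data.Sum using (_⊎_; inj₁; inj₂; [_,_]; map₁)
open import Data.Unit using (tt)
open import Data.Vec using (Vec; []; _∷_; map; _++_; tabulate; lookup; replicate; take; drop)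
open import Data.Vec.Properties
  using (map-∘; map-cong; map-++; subst-is-cast; cast-sym; ++-assoc-eqFree; ≡-dec;
         tabulate-∘; tabulate-cong; tabulate∘lookup; lookup-map; lookup∘tabulate)
import Data.Vec.Functional as Vector
import Data.Vec.Functional.Properties as Vector
open import Function using (_∘_)
open import Function.Bundles using (_⇔_; mk⇔; Equivalence)
open import Function.Properties.Equivalence using () renaming (refl to ⇔-refl; trans to ⇔-trans)
open import Function.Related.TypeIsomorphisms using (→-cong-⇔; ¬-cong-⇔)
open import Data.Product.Function.NonDependent.Propositional using (_×-⇔_)
open import Data.Sum.Function.Propositional using (_⊎-⇔_)
open import Relation.Binary.PropositionalEquality
  using (_≡_; refl; sym; trans; cong; cong₂; subst; module ≡-Reasoning)
open import Relation.Nullary using (¬_; Dec; yes; no; ¬?)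
open import Relation.Nullary.Decidable using (⌊_⌋; map′; toWitness; fromWitness)

≡⇒⇔ : ∀ {P Q : Set} → P ≡ Q → P ⇔ Q
≡⇒⇔ refl = mk⇔ (λ p → p) (λ p → p)

Π-⇔ : ∀ {I : Set} {P Q : I → Set} → (∀ i → P i ⇔ Q i) → (∀ i → P i) ⇔ (∀ i → Q i)
Π-⇔ P⇔Q = mk⇔ (λ f i → Equivalence.to (P⇔Q i) (f i)) (λ g i → Equivalence.from (P⇔Q i) (g i))

∃-⇔ : ∀ {I : Set} {P Q : I → Set} → (∀ i → P i ⇔ Q i) → Σ I P ⇔ Σ I Q
∃-⇔ P⇔Q = mk⇔ (λ (i , p) → i , Equivalence.to (P⇔Q i) p)
              (λ (i , q) → i , Equivalence.from (P⇔Q i) q)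

All-map-⇔ : ∀ {X Y : Set} {P : Y → Set} {Q : X → Set} {f : X → Y} →
            (∀ x → P (f x) ⇔ Q x) → ∀ xs → All P (L.map f xs) ⇔ All Q xs
All-map-⇔ P∘f⇔Q xs = mk⇔ (All.map (λ {x} → Equivalence.to (P∘f⇔Q x)) ∘ All.map⁻)
                         (All.map⁺ ∘ All.map (λ {x} → Equivalence.from (P∘f⇔Q x)))

map-∘≗ : ∀ {X Y Z : Set} {ι : X → Y} {e : Y → Z} {e′ : X → Z} → (∀ x → e (ι x) ≡ e′ x) →
         ∀ {k} (xs : Vec X k) → map e (map ι xs) ≡ map e′ xs
map-∘≗ {ι = ι} {e} e∘ι≗e′ xs = trans (sym (map-∘ e ι xs)) (map-cong e∘ι≗e′ xs)

module _ {A : Set} where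

  uncurry-++ : ∀ m {l} {X : Set} → (Vec A m → Vec A l → X) → Vec A (m + l) → X
  uncurry-++ m f w = f (take m w) (drop m w)

  uncurry-++-++ : ∀ {m l} {X : Set} (f : Vec A m → Vec A l → X) (v : Vec A m) (w : Vec A l) →
                  uncurry-++ m f (v ++ w) ≡ f v w
  uncurry-++-++ f []      w = refl
  uncurry-++-++ f (x ∷ v) w = uncurry-++-++ (λ v′ → f (x ∷ v′)) v w

module _ {n : ℕ} where

  _≢ᵇ_ : ∀ {k} → Vec (Fin n) k → Vec (Fin n) k → Bool
  v ≢ᵇ w = ⌊ ¬? (≡-dec Fin._≟_ v w) ⌋

  T-≢ᵇ : ∀ {k} {v w : Vec (Fin n) k} → T (v ≢ᵇ w) ⇔ (¬ v ≡ w)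
  T-≢ᵇ = mk⇔ toWitness fromWitness

  ∀-Vec? : ∀ k {P : Vec (Fin n) k → Set} → (∀ v → Dec (P v)) → Dec (∀ v → P v)
  ∀-Vec? zero    P? = map′ (λ p → λ { [] → p }) (λ f → f []) (P? [])
  ∀-Vec? (suc k) P? = map′ (λ f → λ { (x ∷ v) → f x v }) (λ f x v → f (x ∷ v))
                           (Fin.all? (λ x → ∀-Vec? k (λ v → P? (x ∷ v))))

Arities : List (Quant × ℕ) → List ℕ
Arities = L.map proj₂

Existentials : List (Quant × ℕ) → Set
Existentials = All (λ q → proj₁ q ≡ ∃Q)

idxˡ : ∀ pre post {k} → Idx (Arities pre) k → Idx (Arities (pre L.++ post)) k
idxˡ (_ ∷ pre) post here      = here
idxˡ (_ ∷ pre) post (there i) = there (idxˡ pre post i)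

idxʳ : ∀ pre post {k} → Idx (Arities post) k → Idx (Arities (pre L.++ post)) k
idxʳ []        post i = i
idxʳ (_ ∷ pre) post i = there (idxʳ pre post i)

splitIdx : ∀ pre post {k} → Idx (Arities (pre L.++ post)) k →
           Idx (Arities pre) k ⊎ Idx (Arities post) k
splitIdx []        post i         = inj₂ i
splitIdx (_ ∷ pre) post here      = inj₁ here
splitIdx (_ ∷ pre) post (there i) = map₁ there (splitIdx pre post i)

module _ {A : Set} where

  _⊆ₑ_ : ∀ {Σ} → Env A Σ → Env A Σ → Set
  ρ ⊆ₑ ρ′ = ∀ {k} (R : Idx _ k) v → T (ρ R v) → T (ρ′ R v)

  _≗ₑ_ : ∀ {Σ} → Env A Σ → Env A Σ → Set
  ρ ≗ₑ ρ′ = ∀ {k} (R : Idx _ k) v → ρ R v ≡ ρ′ R v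

  ⋂_⊆ₑ_ : ∀ {Σ} {I : Set} → (I → Env A Σ) → Env A Σ → Set
  ⋂ ρs ⊆ₑ ρ = ∀ {k} (R : Idx _ k) v → (∀ i → T (ρs i R v)) → T (ρ R v)

  ≗ₑ⇒⊆ₑ : ∀ {Σ} {ρ ρ′ : Env A Σ} → ρ ≗ₑ ρ′ → ρ ⊆ₑ ρ′
  ≗ₑ⇒⊆ₑ ρ≗ρ′ R v = subst T (ρ≗ρ′ R v)

  ≗ₑ-sym : ∀ {Σ} {ρ ρ′ : Env A Σ} → ρ ≗ₑ ρ′ → ρ′ ≗ₑ ρ
  ≗ₑ-sym ρ≗ρ′ R v = sym (ρ≗ρ′ R v)

  ≗ₑ-trans : ∀ {Σ} {ρ ρ′ ρ″ : Env A Σ} → ρ ≗ₑ ρ′ → ρ′ ≗ₑ ρ″ → ρ ≗ₑ ρ″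
  ≗ₑ-trans ρ≗ρ′ ρ′≗ρ″ R v = trans (ρ≗ρ′ R v) (ρ′≗ρ″ R v)

  tailₑ : ∀ {k Σ} → Env A (k ∷ Σ) → Env A Σ
  tailₑ ρ R = ρ (there R)

  concatEnv : ∀ pre {post} → Env A (Arities pre) → Env A (Arities post) →
              Env A (Arities (pre L.++ post))
  concatEnv []        ρ₁ ρ₂ = ρ₂
  concatEnv (_ ∷ pre) ρ₁ ρ₂ = ρ₁ here ∷ₑ concatEnv pre (tailₑ ρ₁) ρ₂

  concatEnv-idxˡ : ∀ pre {post} (ρ₁ : Env A (Arities pre)) (ρ₂ : Env A (Arities post)) →
                   ∀ {k} (R : Idx (Arities pre) k) v →
                   concatEnv pre ρ₁ ρ₂ (idxˡ pre post R) v ≡ ρ₁ R v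
  concatEnv-idxˡ (_ ∷ pre) ρ₁ ρ₂ here      v = refl
  concatEnv-idxˡ (_ ∷ pre) ρ₁ ρ₂ (there R) v = concatEnv-idxˡ pre (tailₑ ρ₁) ρ₂ R v

  concatEnv-idxʳ : ∀ pre {post} (ρ₁ : Env A (Arities pre)) (ρ₂ : Env A (Arities post)) →
                   ∀ {k} (R : Idx (Arities post) k) v →
                   concatEnv pre ρ₁ ρ₂ (idxʳ pre post R) v ≡ ρ₂ R v
  concatEnv-idxʳ []        ρ₁ ρ₂ R v = refl
  concatEnv-idxʳ (_ ∷ pre) ρ₁ ρ₂ R v = concatEnv-idxʳ pre (tailₑ ρ₁) ρ₂ R v

  concatEnv-⊆ₑ : ∀ pre {post} (ρ₁ : Env A (Arities pre)) {ρ₂ ρ₂′ : Env A (Arities post)} →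
                 ρ₂ ⊆ₑ ρ₂′ → concatEnv pre ρ₁ ρ₂ ⊆ₑ concatEnv pre ρ₁ ρ₂′
  concatEnv-⊆ₑ []        ρ₁ ρ₂⊆ρ₂′ = ρ₂⊆ρ₂′
  concatEnv-⊆ₑ (_ ∷ pre) ρ₁ ρ₂⊆ρ₂′ here      v = λ x → x
  concatEnv-⊆ₑ (_ ∷ pre) ρ₁ ρ₂⊆ρ₂′ (there R) = concatEnv-⊆ₑ pre (tailₑ ρ₁) ρ₂⊆ρ₂′ R

  concatEnv-≗ₑ : ∀ pre {post} (ρ₁ : Env A (Arities pre)) {ρ₂ ρ₂′ : Env A (Arities post)} →
                 ρ₂ ≗ₑ ρ₂′ → concatEnv pre ρ₁ ρ₂ ≗ₑ concatEnv pre ρ₁ ρ₂′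
  concatEnv-≗ₑ []        ρ₁ ρ₂≗ρ₂′ = ρ₂≗ρ₂′
  concatEnv-≗ₑ (_ ∷ pre) ρ₁ ρ₂≗ρ₂′ here      v = refl
  concatEnv-≗ₑ (_ ∷ pre) ρ₁ ρ₂≗ρ₂′ (there R) = concatEnv-≗ₑ pre (tailₑ ρ₁) ρ₂≗ρ₂′ R

  concatEnv-⋂ : ∀ pre {post} (ρ₁ : Env A (Arities pre)) {I : Set} → I →
                {ρ₂s : I → Env A (Arities post)} {ρ₂ : Env A (Arities post)} →
                ⋂ ρ₂s ⊆ₑ ρ₂ → ⋂ (λ i → concatEnv pre ρ₁ (ρ₂s i)) ⊆ₑ concatEnv pre ρ₁ ρ₂
  concatEnv-⋂ []        ρ₁ i₀ ⋂⊆ = ⋂⊆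
  concatEnv-⋂ (_ ∷ pre) ρ₁ i₀ ⋂⊆ here      v hs = hs i₀
  concatEnv-⋂ (_ ∷ pre) ρ₁ i₀ ⋂⊆ (there R) = concatEnv-⋂ pre (tailₑ ρ₁) i₀ ⋂⊆ R

  concatEnv-split : ∀ pre {post} (ρ₁ : Env A (Arities pre)) (ρ₂ : Env A (Arities post)) →
                    ∀ {k} (R : Idx (Arities (pre L.++ post)) k) v →
                    concatEnv pre ρ₁ ρ₂ R v
                    ≡ [ (λ R₁ → ρ₁ R₁ v) , (λ R₂ → ρ₂ R₂ v) ] (splitIdx pre post R)
  concatEnv-split []        ρ₁ ρ₂ R         v = refl
  concatEnv-split (_ ∷ pre) ρ₁ ρ₂ here      v = refl
  concatEnv-split (_ ∷ pre) {post} ρ₁ ρ₂ (there R) v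
    with splitIdx pre post R | concatEnv-split pre (tailₑ ρ₁) ρ₂ R v
  ... | inj₁ _ | IH = IH
  ... | inj₂ _ | IH = IH

  alpha-mono : ∀ {Σ p} {ρ ρ′ : Env A Σ} → ρ ⊆ₑ ρ′ → (α : Alpha Σ p) (e : Fin p → A) →
               evalAlpha ρ α e → evalAlpha ρ′ α e
  alpha-mono ρ⊆ρ′ (atom R xs)   e = ρ⊆ρ′ R _
  alpha-mono ρ⊆ρ′ (univ j R zs) e h ys = ρ⊆ρ′ R _ (h ys)

  head-mono : ∀ {Σ p} {ρ ρ′ : Env A Σ} → ρ ⊆ₑ ρ′ → (H : Head Σ p) (e : Fin p → A) →
              evalHead ρ H e → evalHead ρ′ H e
  head-mono ρ⊆ρ′ (rhead R zs) e = ρ⊆ρ′ R _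
  head-mono ρ⊆ρ′ bot          e = λ ()

  module _ {B : ℕ → Set} (⟦_⟧ : ∀ {m} → B m → (Fin m → A) → Set) where

    Satisfies : ∀ {Σ p} → Env A Σ → List (Clause B Σ p) → Set
    Satisfies {p = p} ρ cs = (e : Fin p → A) → All (λ c → evalClause ⟦_⟧ ρ c e) cs

    evalClause-resp : ∀ {Σ p} {ρ ρ′ : Env A Σ} → ρ ≗ₑ ρ′ → (c : Clause B Σ p) (e : Fin p → A) →
                      evalClause ⟦_⟧ ρ c e → evalClause ⟦_⟧ ρ′ c e
    evalClause-resp ρ≗ρ′ (clause as bs H) e sat αs βs =
      head-mono (≗ₑ⇒⊆ₑ ρ≗ρ′) H e
        (sat (All.map (λ {α} → alpha-mono (≗ₑ⇒⊆ₑ (≗ₑ-sym ρ≗ρ′)) α e) αs) βs)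

    evalClause-≗ₑ : ∀ {Σ p} {ρ ρ′ : Env A Σ} → ρ ≗ₑ ρ′ → (c : Clause B Σ p) (e : Fin p → A) →
                    evalClause ⟦_⟧ ρ c e ⇔ evalClause ⟦_⟧ ρ′ c e
    evalClause-≗ₑ ρ≗ρ′ c e = mk⇔ (evalClause-resp ρ≗ρ′ c e) (evalClause-resp (≗ₑ-sym ρ≗ρ′) c e)

    Satisfies-resp : ∀ {Σ p} {ρ ρ′ : Env A Σ} {cs : List (Clause B Σ p)} → ρ ≗ₑ ρ′ →
                     Satisfies ρ cs → Satisfies ρ′ cs
    Satisfies-resp ρ≗ρ′ sat e = All.map (λ {c} → evalClause-resp ρ≗ρ′ c e) (sat e)

    evalClause-⋂ : ∀ {Σ p} {I : Set} → I → (ρs : I → Env A Σ) {ρ : Env A Σ} →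
                   (∀ i → ρ ⊆ₑ ρs i) → ⋂ ρs ⊆ₑ ρ → (c : Clause B Σ p) (e : Fin p → A) →
                   (∀ i → evalClause ⟦_⟧ (ρs i) c e) → evalClause ⟦_⟧ ρ c e
    evalClause-⋂ i₀ ρs ρ⊆ρs ⋂ρs⊆ρ (clause as bs H) e sat αs βs =
      evalHead-⋂ H (λ i → sat i (All.map (λ {α} → alpha-mono (ρ⊆ρs i) α e) αs) βs)
      where
        evalHead-⋂ : ∀ H → (∀ i → evalHead (ρs i) H e) → evalHead _ H e
        evalHead-⋂ (rhead R zs) = ⋂ρs⊆ρ R _
        evalHead-⋂ bot          = λ hs → hs i₀

  evalPrefix-++-mono : ∀ pre {post post′} {K : Env A (Arities (pre L.++ post)) → Set}
                       {K′ : Env A (Arities (pre L.++ post′)) → Set} →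
                       (∀ (ρ₁ : Env A (Arities pre)) →
                          evalPrefix post (λ ρ₂ → K (concatEnv pre ρ₁ ρ₂)) →
                          evalPrefix post′ (λ ρ₂ → K′ (concatEnv pre ρ₁ ρ₂))) →
                       evalPrefix (pre L.++ post) K → evalPrefix (pre L.++ post′) K′
  evalPrefix-++-mono []               f = f emptyEnv
  evalPrefix-++-mono ((∀Q , k) ∷ pre) f h =
    λ R → evalPrefix-++-mono pre (λ (ρ₁ : Env A (Arities pre)) → f (R ∷ₑ ρ₁)) (h R)
  evalPrefix-++-mono ((∃Q , k) ∷ pre) f (R , h) =
    R , evalPrefix-++-mono pre (λ (ρ₁ : Env A (Arities pre)) → f (R ∷ₑ ρ₁)) h

  evalPrefix-∃⁻ : ∀ {es} → Existentials es → {K : Env A (Arities es) → Set} →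
                  evalPrefix es K → Σ (Env A (Arities es)) K
  evalPrefix-∃⁻ []           h       = emptyEnv , h
  evalPrefix-∃⁻ (refl ∷ ∃es) (R , h) with evalPrefix-∃⁻ ∃es h
  ... | ρ , Kρ = R ∷ₑ ρ , Kρ

  evalPrefix-∃⁺ : ∀ {es} → Existentials es → {K : Env A (Arities es) → Set} →
                  (∀ {ρ ρ′ : Env A (Arities es)} → ρ ≗ₑ ρ′ → K ρ → K ρ′) →
                  (ρ : Env A (Arities es)) → K ρ → evalPrefix es K
  evalPrefix-∃⁺ []           K-resp ρ Kρ = K-resp (λ ()) Kρ
  evalPrefix-∃⁺ (refl ∷ ∃es) K-resp ρ Kρ =
    ρ here , evalPrefix-∃⁺ ∃es (λ ρ≗ρ′ → K-resp (λ { here v → refl ; (there R) v → ρ≗ρ′ R v }))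
                           (tailₑ ρ) (K-resp (λ { here v → refl ; (there R) v → refl }) Kρ)

record SideSyntax (B : ℕ → Set) : Set where
  infix 4 _≐_ _≠_
  field
    _≐_ _≠_ : ∀ {m} → Fin m → Fin m → B m
    rename  : ∀ {m m′} → (Fin m → Fin m′) → B m → B m′

record SideSemantics {B : ℕ → Set} (S : SideSyntax B) (A : Set)
                     (⟦_⟧ : ∀ {m} → B m → (Fin m → A) → Set) : Set where
  open SideSyntax S
  field
    ⟦≐⟧      : ∀ {m} {x y : Fin m} {e} → ⟦ x ≐ y ⟧ e ⇔ (e x ≡ e y)
    ⟦≠⟧      : ∀ {m} {x y : Fin m} {e} → ⟦ x ≠ y ⟧ e ⇔ (¬ e x ≡ e y)
    ⟦rename⟧ : ∀ {m m′} {ι : Fin m → Fin m′} {e e′} → (∀ x → e (ι x) ≡ e′ x) →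
               ∀ b → ⟦ rename ι b ⟧ e ⇔ ⟦ b ⟧ e′

data Target (Σ′ : List ℕ) (p′ k : ℕ) : Set where
  var     : Idx Σ′ k → Target Σ′ p′ k
  section : ∀ {c} → Idx Σ′ (k + c) → Vec (Fin p′) c → Target Σ′ p′ k

RelSubst : List ℕ → List ℕ → ℕ → Set
RelSubst Σ Σ′ p′ = ∀ {k} → Idx Σ k → Target Σ′ p′ k

⟦_⟧ᵗ : ∀ {A : Set} {Σ′ p′ k} → Target Σ′ p′ k → Env A Σ′ → (Fin p′ → A) → Vec A k → Bool
⟦ var R        ⟧ᵗ ρ e v = ρ R v
⟦ section R as ⟧ᵗ ρ e v = ρ R (v ++ map e as)

pullback : ∀ {A : Set} {Σ Σ′ p′} → RelSubst Σ Σ′ p′ → Env A Σ′ → (Fin p′ → A) → Env A Σ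
pullback σ ρ e R = ⟦ σ R ⟧ᵗ ρ e

module Substitution {Σ Σ′ : List ℕ} {p p′ : ℕ} (σ : RelSubst Σ Σ′ p′) (ι : Fin p → Fin p′) where

  atomᵗ : ∀ {k} → Target Σ′ p′ k → Vec (Fin p′) k → Alpha Σ′ p′
  atomᵗ (var R)        xs = atom R xs
  atomᵗ (section R as) xs = atom R (xs ++ as)

  univᵗ : ∀ j {l} → Target Σ′ p′ (j + l) → Vec (Fin p′) l → Alpha Σ′ p′
  univᵗ j     (var R)            zs = univ j R zs
  univᵗ j {l} (section {c} R as) zs = univ j (subst (Idx Σ′) (+-assoc j l c) R) (zs ++ as)

  headᵗ : ∀ {k} → Target Σ′ p′ k → Vec (Fin p′) k → Head Σ′ p′
  headᵗ (var R)        xs = rhead R xs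
  headᵗ (section R as) xs = rhead R (xs ++ as)

  substAlpha : Alpha Σ p → Alpha Σ′ p′
  substAlpha (atom R xs)   = atomᵗ (σ R) (map ι xs)
  substAlpha (univ j R zs) = univᵗ j (σ R) (map ι zs)

  substHead : Head Σ p → Head Σ′ p′
  substHead (rhead R xs) = headᵗ (σ R) (map ι xs)
  substHead bot          = bot

  substClause : ∀ {B} → SideSyntax B → Clause B Σ p → Clause B Σ′ p′
  substClause S (clause as bs H) =
    clause (L.map substAlpha as) (L.map (SideSyntax.rename S ι) bs) (substHead H)

  module _ {A : Set} (ρ : Env A Σ′) {e : Fin p′ → A} {e′ : Fin p → A}
           (e∘ι≗e′ : ∀ x → e (ι x) ≡ e′ x) where

    map-ι-++ : ∀ {k c} (xs : Vec (Fin p) k) (as : Vec (Fin p′) c) →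
               map e (map ι xs ++ as) ≡ map e′ xs ++ map e as
    map-ι-++ xs as = trans (map-++ e (map ι xs) as) (cong (_++ map e as) (map-∘≗ e∘ι≗e′ xs))

    atomᵗ-eval : ∀ {k} (t : Target Σ′ p′ k) (xs : Vec (Fin p) k) →
                 evalAlpha ρ (atomᵗ t (map ι xs)) e ≡ T (⟦ t ⟧ᵗ ρ e (map e′ xs))
    atomᵗ-eval (var R)        xs = cong (T ∘ ρ R) (map-∘≗ e∘ι≗e′ xs)
    atomᵗ-eval (section R as) xs = cong (T ∘ ρ R) (map-ι-++ xs as)

    headᵗ-eval : ∀ {k} (t : Target Σ′ p′ k) (xs : Vec (Fin p) k) →
                 evalHead ρ (headᵗ t (map ι xs)) e ≡ T (⟦ t ⟧ᵗ ρ e (map e′ xs))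
    headᵗ-eval (var R)        xs = cong (T ∘ ρ R) (map-∘≗ e∘ι≗e′ xs)
    headᵗ-eval (section R as) xs = cong (T ∘ ρ R) (map-ι-++ xs as)

    apply-subst : ∀ {a b} (a≡b : a ≡ b) (R : Idx Σ′ a) (w : Vec A b) →
                  ρ (subst (Idx Σ′) a≡b R) w ≡ ρ R (subst (Vec A) (sym a≡b) w)
    apply-subst refl R w = refl

    reassociate : ∀ {j l c} (ys : Vec A j) (us : Vec A l) (ws : Vec A c) →
                  subst (Vec A) (sym (+-assoc j l c)) (ys ++ (us ++ ws)) ≡ (ys ++ us) ++ ws
    reassociate {j} {l} {c} ys us ws =
      trans (subst-is-cast (sym (+-assoc j l c)) _)
            (cast-sym (+-assoc j l c) (++-assoc-eqFree ys us ws))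

    univᵗ-eval : ∀ j {l} (t : Target Σ′ p′ (j + l)) (zs : Vec (Fin p) l) →
                 evalAlpha ρ (univᵗ j t (map ι zs)) e
                 ⇔ ((ys : Vec A j) → T (⟦ t ⟧ᵗ ρ e (ys ++ map e′ zs)))
    univᵗ-eval j (var R) zs = Π-⇔ λ ys → ≡⇒⇔ (cong (λ w → T (ρ R (ys ++ w))) (map-∘≗ e∘ι≗e′ zs))
    univᵗ-eval j {l} (section {c} R as) zs = Π-⇔ λ ys → ≡⇒⇔ (cong T (begin
      ρ (subst (Idx Σ′) (+-assoc j l c) R) (ys ++ map e (map ι zs ++ as))
        ≡⟨ apply-subst (+-assoc j l c) R _ ⟩
      ρ R (subst (Vec A) (sym (+-assoc j l c)) (ys ++ map e (map ι zs ++ as)))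
        ≡⟨ cong (λ w → ρ R (subst (Vec A) (sym (+-assoc j l c)) (ys ++ w))) (map-ι-++ zs as) ⟩
      ρ R (subst (Vec A) (sym (+-assoc j l c)) (ys ++ (map e′ zs ++ map e as)))
        ≡⟨ cong (ρ R) (reassociate ys (map e′ zs) (map e as)) ⟩
      ρ R ((ys ++ map e′ zs) ++ map e as) ∎))
      where open ≡-Reasoning

    substAlpha-eval : (α : Alpha Σ p) →
                      evalAlpha ρ (substAlpha α) e ⇔ evalAlpha (pullback σ ρ e) α e′
    substAlpha-eval (atom R xs)   = ≡⇒⇔ (atomᵗ-eval (σ R) xs)
    substAlpha-eval (univ j R zs) = univᵗ-eval j (σ R) zs

    substHead-eval : (H : Head Σ p) →
                     evalHead ρ (substHead H) e ⇔ evalHead (pullback σ ρ e) H e′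
    substHead-eval (rhead R xs) = ≡⇒⇔ (headᵗ-eval (σ R) xs)
    substHead-eval bot          = ≡⇒⇔ refl

    substClause-eval : ∀ {B} {S : SideSyntax B} {⟦_⟧ : ∀ {m} → B m → (Fin m → A) → Set} →
                       SideSemantics S A ⟦_⟧ → (c : Clause B Σ p) →
                       evalClause ⟦_⟧ ρ (substClause S c) e ⇔ evalClause ⟦_⟧ (pullback σ ρ e) c e′
    substClause-eval sem (clause as bs H) =
      →-cong-⇔ (All-map-⇔ substAlpha-eval as)
        (→-cong-⇔ (All-map-⇔ (SideSemantics.⟦rename⟧ sem e∘ι≗e′) bs) (substHead-eval H))

module _ (pre : List (Quant × ℕ)) {post post′ : List (Quant × ℕ)} {p′ : ℕ} where

  liftᵗ : ∀ {k} → Target (Arities post′) p′ k → Target (Arities (pre L.++ post′)) p′ k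
  liftᵗ (var R)        = var (idxʳ pre post′ R)
  liftᵗ (section R as) = section (idxʳ pre post′ R) as

  underPrefixᵗ : RelSubst (Arities post) (Arities post′) p′ →
                 ∀ {k} → Idx (Arities pre) k ⊎ Idx (Arities post) k → Target (Arities (pre L.++ post′)) p′ k
  underPrefixᵗ σ (inj₁ R₁) = var (idxˡ pre post′ R₁)
  underPrefixᵗ σ (inj₂ R₂) = liftᵗ (σ R₂)

  underPrefix : RelSubst (Arities post) (Arities post′) p′ →
                RelSubst (Arities (pre L.++ post)) (Arities (pre L.++ post′)) p′
  underPrefix σ R = underPrefixᵗ σ (splitIdx pre post R)

  pullback-underPrefix : ∀ {A : Set} (σ : RelSubst (Arities post) (Arities post′) p′)
                         (ρ₁ : Env A (Arities pre)) (ρ₂ : Env A (Arities post′)) (e : Fin p′ → A) →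
                         pullback (underPrefix σ) (concatEnv pre ρ₁ ρ₂) e
                         ≗ₑ concatEnv pre ρ₁ (pullback σ ρ₂ e)
  pullback-underPrefix σ ρ₁ ρ₂ e R v =
    trans (by-cases (splitIdx pre post R)) (sym (concatEnv-split pre ρ₁ (pullback σ ρ₂ e) R v))
    where
      liftᵗ-eval : ∀ {k} (t : Target (Arities post′) p′ k) v →
                   ⟦ liftᵗ t ⟧ᵗ (concatEnv pre ρ₁ ρ₂) e v ≡ ⟦ t ⟧ᵗ ρ₂ e v
      liftᵗ-eval (var R)        v = concatEnv-idxʳ pre ρ₁ ρ₂ R v
      liftᵗ-eval (section R as) v = concatEnv-idxʳ pre ρ₁ ρ₂ R _

      by-cases : ∀ s → ⟦ underPrefixᵗ σ s ⟧ᵗ (concatEnv pre ρ₁ ρ₂) e v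
                       ≡ [ (λ R₁ → ρ₁ R₁ v) , (λ R₂ → pullback σ ρ₂ e R₂ v) ] s
      by-cases (inj₁ R₁) = concatEnv-idxˡ pre ρ₁ ρ₂ R₁ v
      by-cases (inj₂ R₂) = liftᵗ-eval (σ R₂) v

-- Q ∀R ∃S ∀x C becomes Q ∃E ∃F ∃S′ ∃S″ ∀x a b (constraints ∧ C[E(·,a), S′(·,a) / R, S] ∧ C[F, S″ / R, S]),
-- where the constraints say that F is total and E(b, a) holds iff b ≢ a.
module ForallElimination {B : ℕ → Set} (S : SideSyntax B)
                         (pre : List (Quant × ℕ)) (k : ℕ) (es : List (Quant × ℕ)) (p : ℕ) where
  open SideSyntax S

  parametrise : Quant × ℕ → Quant × ℕ
  parametrise q = ∃Q , proj₂ q + k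

  inner inner′ : List (Quant × ℕ)
  inner  = (∀Q , k) ∷ es
  inner′ = (∃Q , k + k) ∷ (∃Q , k) ∷ (L.map parametrise es L.++ es)

  p′ : ℕ
  p′ = p + (k + k)

  xVar : Fin p → Fin p′
  xVar i = i ↑ˡ (k + k)

  aVar bVar : Fin k → Fin p′
  aVar i = p ↑ʳ (i ↑ˡ k)
  bVar i = p ↑ʳ (k ↑ʳ i)

  aVars bVars : Vec (Fin p′) k
  aVars = tabulate aVar
  bVars = tabulate bVar

  shift : ∀ xs {t} → Idx (Arities xs) t → Idx (Arities (L.map parametrise xs)) (t + k)
  shift (_ ∷ xs) here      = here
  shift (_ ∷ xs) (there i) = there (shift xs i)

  E : Idx (Arities inner′) (k + k)
  E = here

  F : Idx (Arities inner′) k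
  F = there here

  S′ : ∀ {t} → Idx (Arities es) t → Idx (Arities inner′) (t + k)
  S′ i = there (there (idxˡ (L.map parametrise es) es (shift es i)))

  S″ : ∀ {t} → Idx (Arities es) t → Idx (Arities inner′) t
  S″ i = there (there (idxʳ (L.map parametrise es) es i))

  σ-section σ-total : RelSubst (Arities inner) (Arities inner′) p′
  σ-section here      = section E aVars
  σ-section (there i) = section (S′ i) aVars
  σ-total here      = var F
  σ-total (there i) = var (S″ i)

  F-total-clause : Clause B (Arities (pre L.++ inner′)) p′
  F-total-clause = clause [] [] (rhead (idxʳ pre inner′ F) bVars)

  E-irreflexive-clause : Clause B (Arities (pre L.++ inner′)) p′
  E-irreflexive-clause =
    clause (atom (idxʳ pre inner′ E) (bVars ++ aVars) ∷ []) (L.tabulate (λ i → bVar i ≐ aVar i)) bot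

  E-off-diagonal-clause : Fin k → Clause B (Arities (pre L.++ inner′)) p′
  E-off-diagonal-clause i = clause [] ((bVar i ≠ aVar i) ∷ []) (rhead (idxʳ pre inner′ E) (bVars ++ aVars))

  constraints : List (Clause B (Arities (pre L.++ inner′)) p′)
  constraints = F-total-clause ∷ E-irreflexive-clause ∷ L.tabulate E-off-diagonal-clause

  copy : RelSubst (Arities inner) (Arities inner′) p′ →
         Clause B (Arities (pre L.++ inner)) p → Clause B (Arities (pre L.++ inner′)) p′
  copy σ = Substitution.substClause (underPrefix pre σ) xVar S

  eliminatedClauses : List (Clause B (Arities (pre L.++ inner)) p) →
                      List (Clause B (Arities (pre L.++ inner′)) p′)
  eliminatedClauses cs = constraints L.++ (L.map (copy σ-section) cs L.++ L.map (copy σ-total) cs)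

  ∃inner′ : Existentials es → Existentials inner′
  ∃inner′ ∃es = refl ∷ refl ∷ All.++⁺ (All.map⁺ (All.universal (λ _ → refl) es)) ∃es

  eliminated : List (Clause B (Arities (pre L.++ inner)) p) → SOHorn B
  eliminated cs = soHorn (pre L.++ inner′) p′ (eliminatedClauses cs)

module ForallEliminationCorrect {B : ℕ → Set} {S : SideSyntax B} (n : ℕ)
         {⟦_⟧ : ∀ {m} → B m → (Fin m → Fin (suc n)) → Set} (sem : SideSemantics S (Fin (suc n)) ⟦_⟧)
         (pre : List (Quant × ℕ)) (k : ℕ) {es : List (Quant × ℕ)} (∃es : Existentials es) (p : ℕ) where

  open ForallElimination S pre k es p
  open SideSemantics sem

  A : Set
  A = Fin (suc n)

  assign : (Fin p → A) → Vec A k → Vec A k → Fin p′ → A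
  assign x a b = x Vector.++ (lookup a Vector.++ lookup b)

  assign-x : ∀ x a b i → assign x a b (xVar i) ≡ x i
  assign-x x a b i = Vector.lookup-++ˡ x _ i

  assign-a : ∀ x a b i → assign x a b (aVar i) ≡ lookup a i
  assign-a x a b i = trans (Vector.lookup-++ʳ x _ (i ↑ˡ k)) (Vector.lookup-++ˡ (lookup a) (lookup b) i)

  assign-b : ∀ x a b i → assign x a b (bVar i) ≡ lookup b i
  assign-b x a b i = trans (Vector.lookup-++ʳ x _ (k ↑ʳ i)) (Vector.lookup-++ʳ (lookup a) (lookup b) i)

  map-tabulate-lookup : ∀ (e : Fin p′ → A) {f : Fin k → Fin p′} (a : Vec A k) →
                        (∀ i → e (f i) ≡ lookup a i) → map e (tabulate f) ≡ a
  map-tabulate-lookup e {f} a e∘f≗a =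
    trans (sym (tabulate-∘ e f)) (trans (tabulate-cong e∘f≗a) (tabulate∘lookup a))

  lookup-map-tabulate : ∀ (e : Fin p′ → A) (f : Fin k → Fin p′) i → lookup (map e (tabulate f)) i ≡ e (f i)
  lookup-map-tabulate e f i = trans (lookup-map i e (tabulate f)) (cong e (lookup∘tabulate f i))

  sectionEnv : Env A (Arities inner′) → Vec A k → Env A (Arities inner)
  sectionEnv ρ₂′ a = (λ v → ρ₂′ E (v ++ a)) ∷ₑ (λ i v → ρ₂′ (S′ i) (v ++ a))

  totalEnv : Env A (Arities inner′) → Env A (Arities inner)
  totalEnv ρ₂′ = ρ₂′ F ∷ₑ (λ i → ρ₂′ (S″ i))

  Intended : Env A (Arities inner′) → Set
  Intended ρ₂′ = (∀ v → T (ρ₂′ F v)) × (∀ (b a : Vec A k) → T (ρ₂′ E (b ++ a)) ⇔ (¬ b ≡ a))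

  module _ (ρ₁ : Env A (Arities pre)) (ρ₂′ : Env A (Arities inner′)) where

    copy-eval : ∀ (σ : RelSubst (Arities inner) (Arities inner′) p′) {ρ₂ : Env A (Arities inner)} {e e′} →
                pullback σ ρ₂′ e ≗ₑ ρ₂ →
                (∀ x → e (xVar x) ≡ e′ x) → ∀ c →
                evalClause ⟦_⟧ (concatEnv pre ρ₁ ρ₂′) (copy σ c) e
                ⇔ evalClause ⟦_⟧ (concatEnv pre ρ₁ ρ₂) c e′
    copy-eval σ {e = e} σ*ρ₂′≗ρ₂ e∘x≗e′ c =
      ⇔-trans (Substitution.substClause-eval (underPrefix pre σ) xVar _ e∘x≗e′ sem c)
              (evalClause-≗ₑ ⟦_⟧ (≗ₑ-trans (pullback-underPrefix pre σ ρ₁ ρ₂′ e)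
                                           (concatEnv-≗ₑ pre ρ₁ σ*ρ₂′≗ρ₂)) c _)

    copy-section-eval : ∀ {e e′} → (∀ x → e (xVar x) ≡ e′ x) → ∀ c →
                        evalClause ⟦_⟧ (concatEnv pre ρ₁ ρ₂′) (copy σ-section c) e
                        ⇔ evalClause ⟦_⟧ (concatEnv pre ρ₁ (sectionEnv ρ₂′ (map e aVars))) c e′
    copy-section-eval = copy-eval σ-section λ { here v → refl ; (there i) v → refl }

    copy-total-eval : ∀ {e e′} → (∀ x → e (xVar x) ≡ e′ x) → ∀ c →
                     evalClause ⟦_⟧ (concatEnv pre ρ₁ ρ₂′) (copy σ-total c) e
                     ⇔ evalClause ⟦_⟧ (concatEnv pre ρ₁ (totalEnv ρ₂′)) c e′
    copy-total-eval = copy-eval σ-total λ { here v → refl ; (there i) v → refl }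

    E-value : ∀ e → concatEnv pre ρ₁ ρ₂′ (idxʳ pre inner′ E) (map e (bVars ++ aVars))
                    ≡ ρ₂′ E (map e bVars ++ map e aVars)
    E-value e = trans (concatEnv-idxʳ pre ρ₁ ρ₂′ E _) (cong (ρ₂′ E) (map-++ e bVars aVars))

    constraints-complete : Intended ρ₂′ → Satisfies ⟦_⟧ (concatEnv pre ρ₁ ρ₂′) constraints
    constraints-complete (F-total , E⇔≢) e = F-holds ∷ irreflexive-holds ∷ All.tabulate⁺ off-diagonal-holds
      where
        F-holds : evalClause ⟦_⟧ (concatEnv pre ρ₁ ρ₂′) F-total-clause e
        F-holds [] [] = subst T (sym (concatEnv-idxʳ pre ρ₁ ρ₂′ F _)) (F-total _)

        irreflexive-holds : evalClause ⟦_⟧ (concatEnv pre ρ₁ ρ₂′) E-irreflexive-clause e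
        irreflexive-holds (Eba ∷ []) b≐a = Equivalence.to (E⇔≢ _ _) (subst T (E-value e) Eba) b≡a
          where
            b≡a : map e bVars ≡ map e aVars
            b≡a = trans (sym (tabulate-∘ e bVar))
                        (trans (tabulate-cong (λ i → Equivalence.to ⟦≐⟧ (All.tabulate⁻ b≐a i)))
                               (tabulate-∘ e aVar))

        off-diagonal-holds : ∀ i → evalClause ⟦_⟧ (concatEnv pre ρ₁ ρ₂′) (E-off-diagonal-clause i) e
        off-diagonal-holds i [] (bᵢ≠aᵢ ∷ []) =
          subst T (sym (E-value e)) (Equivalence.from (E⇔≢ (map e bVars) (map e aVars)) λ b≡a →
            Equivalence.to ⟦≠⟧ bᵢ≠aᵢ (trans (sym (lookup-map-tabulate e bVar i))
                                      (trans (cong (λ v → lookup v i) b≡a) (lookup-map-tabulate e aVar i))))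

    constraints-sound : Satisfies ⟦_⟧ (concatEnv pre ρ₁ ρ₂′) constraints → Intended ρ₂′
    constraints-sound sat = F-total , λ b a → mk⇔ (E⇒≢ b a) (≢⇒E b a)
      where
        x₀ : Fin p → A
        x₀ _ = zero

        E-at : ∀ (a b : Vec A k) →
               concatEnv pre ρ₁ ρ₂′ (idxʳ pre inner′ E) (map (assign x₀ a b) (bVars ++ aVars))
               ≡ ρ₂′ E (b ++ a)
        E-at a b = trans (E-value (assign x₀ a b))
                         (cong₂ (λ u w → ρ₂′ E (u ++ w)) (map-tabulate-lookup _ b (assign-b x₀ a b))
                                                         (map-tabulate-lookup _ a (assign-a x₀ a b)))

        F-total : ∀ v → T (ρ₂′ F v)
        F-total v = subst T (trans (concatEnv-idxʳ pre ρ₁ ρ₂′ F _)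
                                   (cong (ρ₂′ F) (map-tabulate-lookup _ v (assign-b x₀ v v))))
                            (All.head (sat (assign x₀ v v)) [] [])

        E⇒≢ : ∀ (b a : Vec A k) → T (ρ₂′ E (b ++ a)) → ¬ b ≡ a
        E⇒≢ a a Eaa refl =
          All.head (All.tail (sat (assign x₀ a a))) (subst T (sym (E-at a a)) Eaa ∷ [])
            (All.tabulate⁺ λ i → Equivalence.from ⟦≐⟧ (trans (assign-b x₀ a a i) (sym (assign-a x₀ a a i))))

        ≢⇒E : ∀ (b a : Vec A k) → ¬ b ≡ a → T (ρ₂′ E (b ++ a))
        ≢⇒E b a b≢a = subst T (E-at a b)
          (All.tabulate⁻ (All.tail (All.tail (sat (assign x₀ a b)))) i []
            (Equivalence.from ⟦≠⟧ (λ eᵢ → bᵢ≢aᵢ (trans (sym (assign-b x₀ a b i))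
                                                      (trans eᵢ (assign-a x₀ a b i))))
             ∷ []))
          where
            b≗a⇒b≡a : (∀ i → lookup b i ≡ lookup a i) → b ≡ a
            b≗a⇒b≡a b≗a = trans (sym (tabulate∘lookup b)) (trans (tabulate-cong b≗a) (tabulate∘lookup a))
            differ = Fin.¬∀⟶∃¬ k (λ i → lookup b i ≡ lookup a i) (λ i → lookup b i Fin.≟ lookup a i)
                               (b≢a ∘ b≗a⇒b≡a)
            i = proj₁ differ
            bᵢ≢aᵢ = proj₂ differ


  shiftedEnv : ∀ xs → (∀ {t} → Idx (Arities xs) t → Vec A (t + k) → Bool) →
               Env A (Arities (L.map parametrise xs))
  shiftedEnv []       g = emptyEnv
  shiftedEnv (_ ∷ xs) g = g here ∷ₑ shiftedEnv xs (λ i → g (there i))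

  shiftedEnv-shift : ∀ xs (g : ∀ {t} → Idx (Arities xs) t → Vec A (t + k) → Bool) →
                     ∀ {t} (i : Idx (Arities xs) t) w → shiftedEnv xs g (shift xs i) w ≡ g i w
  shiftedEnv-shift (_ ∷ xs) g here      w = refl
  shiftedEnv-shift (_ ∷ xs) g (there i) w = shiftedEnv-shift xs (λ j → g (there j)) i w

  module Encoding (witness : (Vec A k → Bool) → Env A (Arities es)) where

    coSingleton : Vec A k → Vec A k → Bool
    coSingleton a v = v ≢ᵇ a

    total : Vec A k → Bool
    total _ = true

    encoding : Env A (Arities inner′)
    encoding = uncurry-++ k _≢ᵇ_ ∷ₑ (total ∷ₑ concatEnv (L.map parametrise es)
                 (shiftedEnv es (λ {t} i → uncurry-++ t (λ v a → witness (coSingleton a) i v)))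
                 (witness total))

    encoding-intended : Intended encoding
    encoding-intended = (λ _ → tt) , λ b a → ⇔-trans (≡⇒⇔ (cong T (uncurry-++-++ _≢ᵇ_ b a))) T-≢ᵇ

    sectionEnv-encoding : ∀ a → sectionEnv encoding a ≗ₑ (coSingleton a ∷ₑ witness (coSingleton a))
    sectionEnv-encoding a here      v = uncurry-++-++ _≢ᵇ_ v a
    sectionEnv-encoding a (there i) v =
      trans (concatEnv-idxˡ (L.map parametrise es) _ (witness total) (shift es i) (v ++ a))
            (trans (shiftedEnv-shift es _ i (v ++ a))
                   (uncurry-++-++ (λ v′ a′ → witness (coSingleton a′) i v′) v a))

    totalEnv-encoding : totalEnv encoding ≗ₑ (total ∷ₑ witness total)
    totalEnv-encoding here      v = refl
    totalEnv-encoding (there i) v = concatEnv-idxʳ (L.map parametrise es) _ (witness total) i v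

  module Meet (ρ₂′ : Env A (Arities inner′)) (intended : Intended ρ₂′) (R : Vec A k → Bool) where

    Index : Set
    Index = Maybe (Σ (Vec A k) λ a → ¬ T (R a))

    component : Index → Env A (Arities inner)
    component nothing        = totalEnv ρ₂′
    component (just (a , _)) = sectionEnv ρ₂′ a

    witness : Env A (Arities es)
    witness i v = ρ₂′ (S″ i) v ∧ ⌊ ∀-Vec? k (λ a → T? (R a ∨ ρ₂′ (S′ i) (v ++ a))) ⌋

    meet-⊆-component : ∀ i → (R ∷ₑ witness) ⊆ₑ component i
    meet-⊆-component nothing          here      v _  = proj₁ intended v
    meet-⊆-component nothing          (there i) v Sv = proj₁ (Equivalence.to T-∧ Sv)
    meet-⊆-component (just (a , ¬Ra)) here      v Rv =
      Equivalence.from (proj₂ intended v a) (λ v≡a → ¬Ra (subst (T ∘ R) v≡a Rv))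
    meet-⊆-component (just (a , ¬Ra)) (there i) v Sv
      with Equivalence.to T-∨ (toWitness (proj₂ (Equivalence.to (T-∧ {ρ₂′ (S″ i) v}) Sv)) a)
    ... | inj₁ Ra   = ⊥-elim (¬Ra Ra)
    ... | inj₂ S′va = S′va

    ⋂component-⊆-meet : ⋂ component ⊆ₑ (R ∷ₑ witness)
    ⋂component-⊆-meet here v inAll with T? (R v)
    ... | yes Rv  = Rv
    ... | no  ¬Rv = ⊥-elim (Equivalence.to (proj₂ intended v v) (inAll (just (v , ¬Rv))) refl)
    ⋂component-⊆-meet (there i) v inAll =
      Equivalence.from (T-∧ {ρ₂′ (S″ i) v})
        (inAll nothing , fromWitness λ a → Equivalence.from T-∨ (in-section a))
      where
        in-section : ∀ a → T (R a) ⊎ T (ρ₂′ (S′ i) (v ++ a))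
        in-section a with T? (R a)
        ... | yes Ra  = inj₁ Ra
        ... | no  ¬Ra = inj₂ (inAll (just (a , ¬Ra)))

  module _ (ρ₁ : Env A (Arities pre)) (cs : List (Clause B (Arities (pre L.++ inner)) p)) where

    Old : Env A (Arities inner) → Set
    Old ρ₂ = Satisfies ⟦_⟧ (concatEnv pre ρ₁ ρ₂) cs

    New : Env A (Arities inner′) → Set
    New ρ₂′ = Satisfies ⟦_⟧ (concatEnv pre ρ₁ ρ₂′) (eliminatedClauses cs)

    Old-resp : ∀ {ρ₂ ρ₂′ : Env A (Arities inner)} → ρ₂ ≗ₑ ρ₂′ → Old ρ₂ → Old ρ₂′
    Old-resp = Satisfies-resp ⟦_⟧ ∘ concatEnv-≗ₑ pre ρ₁

    New-resp : ∀ {ρ₂ ρ₂′ : Env A (Arities inner′)} → ρ₂ ≗ₑ ρ₂′ → New ρ₂ → New ρ₂′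
    New-resp = Satisfies-resp ⟦_⟧ ∘ concatEnv-≗ₑ pre ρ₁

    eliminate⇒ : evalPrefix inner Old → evalPrefix inner′ New
    eliminate⇒ ∀R∃S = evalPrefix-∃⁺ (∃inner′ ∃es) New-resp encoding New-encoding
      where
        witness : (Vec A k → Bool) → Env A (Arities es)
        witness R = proj₁ (evalPrefix-∃⁻ ∃es (∀R∃S R))

        witness-sound : ∀ R → Old (R ∷ₑ witness R)
        witness-sound R = proj₂ (evalPrefix-∃⁻ ∃es (∀R∃S R))

        open Encoding witness

        New-encoding : New encoding
        New-encoding e = All.++⁺ (constraints-complete ρ₁ encoding encoding-intended e) (All.++⁺
          (All.map⁺ (All.map (λ {c} → Equivalence.from (copy-section-eval ρ₁ encoding (λ _ → refl) c))
                             (Old-resp (≗ₑ-sym (sectionEnv-encoding _)) (witness-sound _) (e ∘ xVar))))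
          (All.map⁺ (All.map (λ {c} → Equivalence.from (copy-total-eval ρ₁ encoding (λ _ → refl) c))
                             (Old-resp (≗ₑ-sym totalEnv-encoding) (witness-sound total) (e ∘ xVar)))))

    eliminate⇐ : evalPrefix inner′ New → evalPrefix inner Old
    eliminate⇐ ∃S′ R = evalPrefix-∃⁺ ∃es (λ ρ≗ρ′ → Old-resp λ { here v → refl ; (there i) v → ρ≗ρ′ i v })
                                     witness Old-meet
      where
        ρ₂′ : Env A (Arities inner′)
        ρ₂′ = proj₁ (evalPrefix-∃⁻ (∃inner′ ∃es) {New} ∃S′)

        new : New ρ₂′
        new = proj₂ (evalPrefix-∃⁻ (∃inner′ ∃es) {New} ∃S′)

        open Meet ρ₂′ (constraints-sound ρ₁ ρ₂′ (λ e → All.++⁻ˡ constraints (new e))) R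

        copies : ∀ e → All (λ c → evalClause ⟦_⟧ (concatEnv pre ρ₁ ρ₂′) c e)
                           (L.map (copy σ-section) cs L.++ L.map (copy σ-total) cs)
        copies e = All.++⁻ʳ constraints (new e)

        component-satisfies : ∀ i {c} → c ∈ cs → ∀ e₀ → evalClause ⟦_⟧ (concatEnv pre ρ₁ (component i)) c e₀
        component-satisfies nothing {c} c∈cs e₀ =
          Equivalence.to (copy-total-eval ρ₁ ρ₂′ (assign-x e₀ o o) c)
                         (All.lookup (All.map⁻ (All.++⁻ʳ _ (copies (assign e₀ o o)))) c∈cs)
          where o = replicate k zero
        component-satisfies (just (a , _)) {c} c∈cs e₀ =
          subst (λ a′ → evalClause ⟦_⟧ (concatEnv pre ρ₁ (sectionEnv ρ₂′ a′)) c e₀)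
                (map-tabulate-lookup _ a (assign-a e₀ a a))
                (Equivalence.to (copy-section-eval ρ₁ ρ₂′ (assign-x e₀ a a) c)
                                (All.lookup (All.map⁻ (All.++⁻ˡ _ (copies (assign e₀ a a)))) c∈cs))

        Old-meet : Old (R ∷ₑ witness)
        Old-meet e₀ = All.tabulate λ {c} c∈cs →
          evalClause-⋂ ⟦_⟧ nothing (λ i → concatEnv pre ρ₁ (component i))
                       (λ i → concatEnv-⊆ₑ pre ρ₁ (meet-⊆-component i))
                       (concatEnv-⋂ pre ρ₁ nothing ⋂component-⊆-meet)
                       c e₀ (λ i → component-satisfies i c∈cs e₀)

  eliminate-⇔ : ∀ cs → evalSOHorn ⟦_⟧ (soHorn (pre L.++ inner) p cs) ⇔ evalSOHorn ⟦_⟧ (eliminated cs)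
  eliminate-⇔ cs = mk⇔ (evalPrefix-++-mono pre (λ ρ₁ → eliminate⇒ ρ₁ cs))
                       (evalPrefix-++-mono pre (λ ρ₁ → eliminate⇐ ρ₁ cs))


module Elimination {B : ℕ → Set} (S : SideSyntax B) where

  infix 4 _≋_
  _≋_ : SOHorn B → SOHorn B → Set₁
  φ ≋ ψ = ∀ n {⟦_⟧ : ∀ {m} → B m → (Fin m → Fin (suc n)) → Set} →
          SideSemantics S (Fin (suc n)) ⟦_⟧ → evalSOHorn ⟦_⟧ φ ⇔ evalSOHorn ⟦_⟧ ψ

  #∀ : List (Quant × ℕ) → ℕ
  #∀ []              = 0
  #∀ ((∀Q , _) ∷ qs) = suc (#∀ qs)
  #∀ ((∃Q , _) ∷ qs) = #∀ qs

  #∀-++-∃ : ∀ pre {es} → Existentials es → #∀ (pre L.++ es) ≡ #∀ pre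
  #∀-++-∃ []               []           = refl
  #∀-++-∃ []               (refl ∷ ∃es) = #∀-++-∃ [] ∃es
  #∀-++-∃ ((∀Q , _) ∷ pre) ∃es          = cong suc (#∀-++-∃ pre ∃es)
  #∀-++-∃ ((∃Q , _) ∷ pre) ∃es          = #∀-++-∃ pre ∃es

  #∀-++-∀ : ∀ pre k {es} → Existentials es → #∀ (pre L.++ (∀Q , k) ∷ es) ≡ suc (#∀ pre)
  #∀-++-∀ []               k ∃es = cong suc (#∀-++-∃ [] ∃es)
  #∀-++-∀ ((∀Q , _) ∷ pre) k ∃es = cong suc (#∀-++-∀ pre k ∃es)
  #∀-++-∀ ((∃Q , _) ∷ pre) k ∃es = #∀-++-∀ pre k ∃es

  data LastForall : List (Quant × ℕ) → Set where
    none : ∀ {qs} → Existentials qs → LastForall qs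
    last : ∀ pre k {es} → Existentials es → LastForall (pre L.++ (∀Q , k) ∷ es)

  lastForall : ∀ qs → LastForall qs
  lastForall [] = none []
  lastForall ((∀Q , k) ∷ qs) with lastForall qs
  ... | none ∃qs         = last [] k ∃qs
  ... | last pre k′ ∃es = last ((∀Q , k) ∷ pre) k′ ∃es
  lastForall ((∃Q , k) ∷ qs) with lastForall qs
  ... | none ∃qs         = none (refl ∷ ∃qs)
  ... | last pre k′ ∃es = last ((∃Q , k) ∷ pre) k′ ∃es

  eliminateAll : ∀ N {qs} → LastForall qs → #∀ qs ≡ N → ∀ {p} (cs : List (Clause B (Arities qs) p)) →
                 Σ[ ψ ∈ SOHorn B ] (Existential ψ × soHorn qs p cs ≋ ψ)
  eliminateAll N (none ∃qs) _ cs = soHorn _ _ cs , ∃qs , λ _ _ → ⇔-refl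
  eliminateAll zero (last pre k ∃es) #qs≡0 cs with () ← trans (sym #qs≡0) (#∀-++-∀ pre k ∃es)
  eliminateAll (suc N) (last pre k {es} ∃es) #qs≡1+N {p} cs
    with eliminateAll N (lastForall (pre L.++ inner′))
                      (trans (#∀-++-∃ pre (∃inner′ ∃es))
                             (suc-injective (trans (sym (#∀-++-∀ pre k ∃es)) #qs≡1+N)))
                      (eliminatedClauses cs)
    where open ForallElimination S pre k es p
  ... | ψ , ∃ψ , ≋ψ =
    ψ , ∃ψ , λ n sem → ⇔-trans (ForallEliminationCorrect.eliminate-⇔ n sem pre k ∃es p cs) (≋ψ n sem)

  eliminateForalls : (φ : SOHorn B) → Σ[ ψ ∈ SOHorn B ] (Existential ψ × φ ≋ ψ)
  eliminateForalls (soHorn qs p cs) = eliminateAll (#∀ qs) (lastForall qs) refl cs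

extend-lift : ∀ {A : Set} {m m′} {ι : Fin m → Fin m′} {e : Fin m′ → A} {e′ : Fin m → A} →
              (∀ x → e (ι x) ≡ e′ x) → ∀ a x → extend a e (lift 1 ι x) ≡ extend a e′ x
extend-lift e∘ι≗e′ a zero    = refl
extend-lift e∘ι≗e′ a (suc x) = e∘ι≗e′ x

module _ {τ : Vocab} where

  renameAtom : ∀ {m m′} → (Fin m → Fin m′) → Atom τ m → Atom τ m′
  renameAtom ι (rel P xs) = rel P (map ι xs)
  renameAtom ι (eq x y)   = eq (ι x) (ι y)

  renameLit : ∀ {m m′} → (Fin m → Fin m′) → Lit τ m → Lit τ m′
  renameLit ι (pos a) = pos (renameAtom ι a)
  renameLit ι (neg a) = neg (renameAtom ι a)

  renameFO : ∀ {m m′} → (Fin m → Fin m′) → FO τ m → FO τ m′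
  renameFO ι (rel P xs) = rel P (map ι xs)
  renameFO ι (eq x y)   = eq (ι x) (ι y)
  renameFO ι (neg φ)    = neg (renameFO ι φ)
  renameFO ι (and φ ψ)  = and (renameFO ι φ) (renameFO ι ψ)
  renameFO ι (or φ ψ)   = or (renameFO ι φ) (renameFO ι ψ)
  renameFO ι (all φ)    = all (renameFO (lift 1 ι) φ)
  renameFO ι (ex φ)     = ex (renameFO (lift 1 ι) φ)

  literals : SideSyntax (Lit τ)
  literals = record { _≐_ = λ x y → pos (eq x y) ; _≠_ = λ x y → neg (eq x y) ; rename = renameLit }

  firstOrder : SideSyntax (FO τ)
  firstOrder = record { _≐_ = eq ; _≠_ = λ x y → neg (eq x y) ; rename = renameFO }

  module _ {A : Set} (ρ : Env A τ) where

    evalAtom-rename : ∀ {m m′} {ι : Fin m → Fin m′} {e e′} → (∀ x → e (ι x) ≡ e′ x) →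
                      ∀ a → evalAtom ρ (renameAtom ι a) e ⇔ evalAtom ρ a e′
    evalAtom-rename e∘ι≗e′ (rel P xs) = ≡⇒⇔ (cong (T ∘ ρ P) (map-∘≗ e∘ι≗e′ xs))
    evalAtom-rename e∘ι≗e′ (eq x y)   = ≡⇒⇔ (cong₂ _≡_ (e∘ι≗e′ x) (e∘ι≗e′ y))

    evalLit-rename : ∀ {m m′} {ι : Fin m → Fin m′} {e e′} → (∀ x → e (ι x) ≡ e′ x) →
                     ∀ b → evalLit ρ (renameLit ι b) e ⇔ evalLit ρ b e′
    evalLit-rename e∘ι≗e′ (pos a) = evalAtom-rename e∘ι≗e′ a
    evalLit-rename e∘ι≗e′ (neg a) = ¬-cong-⇔ (evalAtom-rename e∘ι≗e′ a)

    evalFO-rename : ∀ {m m′} {ι : Fin m → Fin m′} {e e′} → (∀ x → e (ι x) ≡ e′ x) →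
                    ∀ φ → evalFO ρ (renameFO ι φ) e ⇔ evalFO ρ φ e′
    evalFO-rename e∘ι≗e′ (rel P xs) = evalAtom-rename e∘ι≗e′ (rel P xs)
    evalFO-rename e∘ι≗e′ (eq x y)   = ≡⇒⇔ (cong₂ _≡_ (e∘ι≗e′ x) (e∘ι≗e′ y))
    evalFO-rename e∘ι≗e′ (neg φ)    = ¬-cong-⇔ (evalFO-rename e∘ι≗e′ φ)
    evalFO-rename e∘ι≗e′ (and φ ψ)  = evalFO-rename e∘ι≗e′ φ ×-⇔ evalFO-rename e∘ι≗e′ ψ
    evalFO-rename e∘ι≗e′ (or φ ψ)   = evalFO-rename e∘ι≗e′ φ ⊎-⇔ evalFO-rename e∘ι≗e′ ψ
    evalFO-rename e∘ι≗e′ (all φ)    = Π-⇔ λ a → evalFO-rename (extend-lift e∘ι≗e′ a) φ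
    evalFO-rename e∘ι≗e′ (ex φ)     = ∃-⇔ λ a → evalFO-rename (extend-lift e∘ι≗e′ a) φ

    literalSemantics : SideSemantics literals A (λ b e → evalLit ρ b e)
    literalSemantics = record { ⟦≐⟧ = ⇔-refl ; ⟦≠⟧ = ⇔-refl ; ⟦rename⟧ = evalLit-rename }

    firstOrderSemantics : SideSemantics firstOrder A (λ φ e → evalFO ρ φ e)
    firstOrderSemantics = record { ⟦≐⟧ = ⇔-refl ; ⟦≠⟧ = ⇔-refl ; ⟦rename⟧ = evalFO-rename }

existential-collapse : ∀ {τ B} (S : SideSyntax B)
                       (⟦_⟧ : (𝔄 : Structure τ) → ∀ {m} → B m → (Fin m → Dom 𝔄) → Set) →
                       (∀ 𝔄 → SideSemantics S (Dom 𝔄) (⟦ 𝔄 ⟧)) → (φ : SOHorn B) →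
                       Σ[ ψ ∈ SOHorn B ]
                         (Existential ψ × ((𝔄 : Structure τ) → evalSOHorn (⟦ 𝔄 ⟧) φ ⇔ evalSOHorn (⟦ 𝔄 ⟧) ψ))
existential-collapse S ⟦_⟧ sem φ with Elimination.eliminateForalls S φ
... | ψ , ∃ψ , φ≋ψ = ψ , ∃ψ , λ 𝔄 → φ≋ψ (Structure.n 𝔄) (sem 𝔄)

corollary1 : (τ : Vocab)
    → ((φ : SO-HORNʳ τ) → Σ[ ψ ∈ SO-HORNʳ τ ]
    (Existential ψ × ((𝔄 : Structure τ) → (𝔄 ⊨ʳ φ) ⇔ (𝔄 ⊨ʳ ψ))))
    × ((φ : SO-HORN*ʳ τ) → Σ[ ψ ∈ SO-HORN*ʳ τ ]
    (Existential ψ × ((𝔄 : Structure τ) → (𝔄 ⊨*ʳ φ) ⇔ (𝔄 ⊨*ʳ ψ))))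
corollary1 τ =
  existential-collapse literals (λ 𝔄 b e → evalLit (Structure.rel 𝔄) b e)
                                (literalSemantics ∘ Structure.rel) ,
  existential-collapse firstOrder (λ 𝔄 φ e → evalFO (Structure.rel 𝔄) φ e)
                                  (firstOrderSemantics ∘ Structure.rel)
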